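{- Let $k\ge 4$, let $H$ be the $k$-th power of the Hamilton cycle on $[n]$, and for $s\le n$ let $H_s$ be the subgraph of $H$ induced by $[s]$. Then for any subgraph $F\subset H$ we have $e(F)\le e(H_{|F|})$.
   Context: $H$ has vertex set $[n]$ and edges $\{v,v+i\}$ for $v\in[n]$, $i\in[k]$ (addition modulo $n$); $n$ is sufficiently large. $|F|$ and $e(F)$ denote the numbers of vertices and edges of $F$. -}

module Defs where

open import Data.Nat using (ℕ; zero; suc; _<_; _<ᵇ_; _≡ᵇ_; _+_; _%_)
open import Data.Bool using (Bool; true; false; _∧_; _∨_; if_then_else_)
open import Data.Fin using (Fin; toℕ)
open import Data.Fin.Subset using (Subset; _∈_)
open import Data.List using (List; map; allFin; upTo)
open import Data.Nat.ListAction using (sum)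
open import Data.Bool.ListAction using (any)
open import Data.Product using (_×_)
open import Relation.Binary.PropositionalEquality using (_≡_)

-- Adjacency in H = k-th power of the Hamilton cycle on n vertices
-- (vertices Fin n = {0,…,n-1}; {u,v} is an edge iff v ≡ u + i or u ≡ v + i (mod n)
-- for some i ∈ {1,…,k}).
adjᵇ : (n k : ℕ) → Fin n → Fin n → Bool
adjᵇ zero k ()
adjᵇ (suc m) k u v =
  any (λ i → (((toℕ u + i) % suc m) ≡ᵇ toℕ v) ∨ (((toℕ v + i) % suc m) ≡ᵇ toℕ u))
      (map suc (upTo k))

countPairs : (n : ℕ) → (Fin n → Fin n → Bool) → ℕ
countPairs n P =
  sum (map (λ u → sum (map (λ v → if P u v then 1 else 0) (allFin n))) (allFin n))

-- e(H_s): edges of H induced by the first s vertices {0,…,s-1};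
-- each edge {u,v} counted once as the pair with toℕ u < toℕ v
eH : (n k s : ℕ) → ℕ
eH n k s = countPairs n (λ u v → (toℕ u <ᵇ toℕ v) ∧ (toℕ v <ᵇ s) ∧ adjᵇ n k u v)

-- A subgraph F of H: vertex set S ⊆ [n] and edge set given by a boolean
-- predicate E on pairs (u , v) with toℕ u < toℕ v (one representative per edge),
-- every edge being an edge of H with both endpoints in S.
IsSubgraph : (n k : ℕ) → Subset n → (Fin n → Fin n → Bool) → Set
IsSubgraph n k S E = ∀ u v → E u v ≡ true →
  (toℕ u < toℕ v) × (adjᵇ n k u v ≡ true) × (u ∈ S) × (v ∈ S)

eF : (n : ℕ) → (Fin n → Fin n → Bool) → ℕ
eF n E = countPairs n E

-- Write pathPowerEdges k s = ∑_{i<s} min(i, k) for the number of edges of the k-th power of a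
-- path on s vertices; H_s contains such a path power. Let f ⊆ [n] have s vertices.
-- If f misses k consecutive vertices, rotate them to the end of [n]: then no edge of H[f] wraps
-- around, every vertex of f has at most min(#earlier vertices of f, k) earlier neighbours, and
-- e(H[f]) ≤ pathPowerEdges k s.
-- If f contains k consecutive vertices, its complement misses them. As H is D-regular,
-- 2e(H[f]) - sD = 2e(H[n ∖ f]) - (n - s)D, and the complement of the interval [s] is a rotated
-- interval, so the comparison for f follows from the one for its complement.
-- Otherwise every vertex has a neighbour of the other colour, so at least n/2 edges leave f and
-- 2e(H[f]) ≤ 2sk - n/2 ≤ 2·pathPowerEdges k s once n ≥ 2k(k+1).

module Submission where

open import Defs
import Data.Bool as Bool
open import Data.Bool using (Bool; true; false; not; _∧_; _∨_; T; if_then_else_)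
open import Data.Bool.Properties using (T-≡; T-∨; ⇔→≡; not-involutive)
open import Data.Bool.ListAction using (any)
open import Data.Empty using (⊥-elim)
open import Data.Fin using (Fin; toℕ; zero; suc)
open import Data.Fin.Subset using (Subset; ∣_∣)
open import Data.List using (List; []; _∷_; map; upTo; applyUpTo; allFin; tabulate)
open import Data.List.Properties using (map-applyUpTo; map-tabulate)
open import Data.List.Relation.Unary.Any.Properties using (any⁺; any⁻; applyUpTo⁺; applyUpTo⁻)
open import Data.Nat
open import Data.Nat.DivMod
open import Data.Nat.ListAction using (sum)
open import Data.Nat.Properties
open import Data.Nat.Tactic.RingSolver using (solve-∀)
open import Algebra.Properties.CommutativeSemigroup +-commutativeSemigroup
  using (xy∙z≈y∙xz; x∙yz≈y∙xz) renaming (interchange to +-interchange)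
open import Data.Product using (_×_; _,_; ∃-syntax)
open import Data.Sum using (_⊎_; inj₁; inj₂)
open import Data.Vec using ([]; _∷_; lookup)
open import Data.Vec.Properties using ([]=⇒lookup)
open import Function using (_∘_; id; const; Equivalence)
open import Function.Bundles using (mk⇔)
open import Relation.Binary.PropositionalEquality
open import Relation.Binary.Definitions using (tri<; tri≈; tri>)
open import Relation.Nullary using (yes; no; ¬?)
open import Relation.Nullary.Decidable using (decidable-stable)

≡ᵇ-true⇒≡ : ∀ a b → (a ≡ᵇ b) ≡ true → a ≡ b
≡ᵇ-true⇒≡ a b e = ≡ᵇ⇒≡ a b (Equivalence.from T-≡ e)

<ᵇ-true : ∀ {u v} → u < v → (u <ᵇ v) ≡ true
<ᵇ-true u<v = Equivalence.to T-≡ (<⇒<ᵇ u<v)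

<ᵇ-false : ∀ {u v} → v ≤ u → (u <ᵇ v) ≡ false
<ᵇ-false {u} {v} v≤u with u <ᵇ v in e
... | false = refl
... | true  = ⊥-elim (<⇒≱ (<ᵇ⇒< u v (Equivalence.from T-≡ e)) v≤u)

𝟙 : Bool → ℕ
𝟙 b = if b then 1 else 0

𝟙≤1 : ∀ b → 𝟙 b ≤ 1
𝟙≤1 true  = ≤-refl
𝟙≤1 false = z≤n

𝟙-mono : ∀ {a b} → (a ≡ true → b ≡ true) → 𝟙 a ≤ 𝟙 b
𝟙-mono {false} _   = z≤n
𝟙-mono {true}  a⇒b rewrite a⇒b refl = ≤-refl

𝟙-∧ : ∀ a b → 𝟙 (a ∧ b) ≡ 𝟙 a * 𝟙 b
𝟙-∧ true  b = sym (+-identityʳ (𝟙 b))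
𝟙-∧ false b = refl

𝟙-∨ : ∀ a b → 𝟙 (a ∨ b) ≤ 𝟙 a + 𝟙 b
𝟙-∨ true  b = s≤s z≤n
𝟙-∨ false b = ≤-refl

𝟙+𝟙-not : ∀ b → 𝟙 b + 𝟙 (not b) ≡ 1
𝟙+𝟙-not true  = refl
𝟙+𝟙-not false = refl

𝟙*-mono : ∀ b {x y} → (b ≡ true → x ≤ y) → 𝟙 b * x ≤ 𝟙 b * y
𝟙*-mono true  x≤y = +-monoˡ-≤ 0 (x≤y refl)
𝟙*-mono false _   = z≤n

𝟙-∧-≤ˡ : ∀ a b → 𝟙 (a ∧ b) ≤ 𝟙 a
𝟙-∧-≤ˡ true  b = 𝟙≤1 b
𝟙-∧-≤ˡ false b = z≤n

𝟙-∧-shuffle : ∀ a b c d → 𝟙 (a ∧ b ∧ c ∧ d) ≡ 𝟙 c * (𝟙 a * 𝟙 (b ∧ d))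
𝟙-∧-shuffle a     b     true  d = trans (𝟙-∧ a (b ∧ d)) (sym (+-identityʳ _))
𝟙-∧-shuffle false b     false d = refl
𝟙-∧-shuffle true  false false d = refl
𝟙-∧-shuffle true  true  false d = refl

-- Sums are indexed by ℕ rather than Fin so that vertices can be rotated
-- modulo n without leaving the index type.
∑< : ℕ → (ℕ → ℕ) → ℕ
∑< zero    f = 0
∑< (suc n) f = f 0 + ∑< n (f ∘ suc)

∑<-cong : ∀ n {f g} → (∀ i → i < n → f i ≡ g i) → ∑< n f ≡ ∑< n g
∑<-cong zero    _   = refl
∑<-cong (suc n) f≡g = cong₂ _+_ (f≡g 0 z<s) (∑<-cong n (λ i i<n → f≡g (suc i) (s<s i<n)))

∑<-mono-≤ : ∀ n {f g} → (∀ i → i < n → f i ≤ g i) → ∑< n f ≤ ∑< n g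
∑<-mono-≤ zero    _   = z≤n
∑<-mono-≤ (suc n) f≤g = +-mono-≤ (f≤g 0 z<s) (∑<-mono-≤ n (λ i i<n → f≤g (suc i) (s<s i<n)))

∑<-const : ∀ n c → ∑< n (const c) ≡ n * c
∑<-const zero    c = refl
∑<-const (suc n) c = cong (c +_) (∑<-const n c)

∑<-≤-const : ∀ n {f} c → (∀ i → i < n → f i ≤ c) → ∑< n f ≤ n * c
∑<-≤-const n c f≤c = ≤-trans (∑<-mono-≤ n f≤c) (≤-reflexive (∑<-const n c))

∑<-zero : ∀ n {f} → (∀ i → i < n → f i ≡ 0) → ∑< n f ≡ 0
∑<-zero n f≡0 = trans (∑<-cong n f≡0) (trans (∑<-const n 0) (*-zeroʳ n))

∑<-distrib-+ : ∀ n f g → ∑< n (λ i → f i + g i) ≡ ∑< n f + ∑< n g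
∑<-distrib-+ zero    f g = refl
∑<-distrib-+ (suc n) f g =
  trans (cong (f 0 + g 0 +_) (∑<-distrib-+ n (f ∘ suc) (g ∘ suc))) (+-interchange (f 0) (g 0) _ _)

∑<-distribˡ-* : ∀ n c f → ∑< n (λ i → c * f i) ≡ c * ∑< n f
∑<-distribˡ-* zero    c f = sym (*-zeroʳ c)
∑<-distribˡ-* (suc n) c f =
  trans (cong (c * f 0 +_) (∑<-distribˡ-* n c (f ∘ suc))) (sym (*-distribˡ-+ c (f 0) _))

∑<-distribʳ-* : ∀ n c f → ∑< n (λ i → f i * c) ≡ ∑< n f * c
∑<-distribʳ-* n c f =
  trans (∑<-cong n (λ i _ → *-comm (f i) c)) (trans (∑<-distribˡ-* n c f) (*-comm c _))

∑<-+ : ∀ m n f → ∑< (m + n) f ≡ ∑< m f + ∑< n (λ i → f (m + i))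
∑<-+ zero    n f = refl
∑<-+ (suc m) n f = trans (cong (f 0 +_) (∑<-+ m n (f ∘ suc))) (sym (+-assoc (f 0) _ _))

∑<-suc : ∀ n f → ∑< (suc n) f ≡ ∑< n f + f n
∑<-suc n f = begin
  ∑< (suc n) f                        ≡⟨ cong (λ m → ∑< m f) (+-comm 1 n) ⟩
  ∑< (n + 1) f                        ≡⟨ ∑<-+ n 1 f ⟩
  ∑< n f + (f (n + 0) + 0)            ≡⟨ cong (λ x → ∑< n f + x) (trans (+-identityʳ _) (cong f (+-identityʳ n))) ⟩
  ∑< n f + f n                        ∎
  where open ≡-Reasoning

∑<-monoˡ-≤ : ∀ {m n} f → m ≤ n → ∑< m f ≤ ∑< n f
∑<-monoˡ-≤ {m} {n} f m≤n = begin
  ∑< m f                                  ≤⟨ m≤m+n (∑< m f) _ ⟩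
  ∑< m f + ∑< (n ∸ m) (λ i → f (m + i))   ≡⟨ ∑<-+ m (n ∸ m) f ⟨
  ∑< (m + (n ∸ m)) f                      ≡⟨ cong (λ l → ∑< l f) (m+[n∸m]≡n m≤n) ⟩
  ∑< n f                                  ∎
  where open ≤-Reasoning

∑<-comm : ∀ m n (f : ℕ → ℕ → ℕ) → ∑< m (λ i → ∑< n (f i)) ≡ ∑< n (λ j → ∑< m (λ i → f i j))
∑<-comm zero    n f = sym (∑<-zero n (λ _ _ → refl))
∑<-comm (suc m) n f =
  trans (cong (∑< n (f 0) +_) (∑<-comm m n (f ∘ suc))) (sym (∑<-distrib-+ n (f 0) _))

term≤∑< : ∀ n f {i} → i < n → f i ≤ ∑< n f
term≤∑< (suc n) f {zero}  _         = m≤m+n (f 0) _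
term≤∑< (suc n) f {suc i} (s<s i<n) = ≤-trans (term≤∑< n (f ∘ suc) i<n) (m≤n+m _ (f 0))

∑<-𝟙-≤1 : ∀ n p → (∀ i j → i < n → j < n → p i ≡ true → p j ≡ true → i ≡ j) → ∑< n (𝟙 ∘ p) ≤ 1
∑<-𝟙-≤1 zero    p unique = z≤n
∑<-𝟙-≤1 (suc n) p unique with p 0 in p0
... | false = ∑<-𝟙-≤1 n (p ∘ suc)
                (λ i j i<n j<n pi pj → suc-injective (unique (suc i) (suc j) (s<s i<n) (s<s j<n) pi pj))
... | true  = s≤s (≤-reflexive (∑<-zero n none))
  where
  none : ∀ i → i < n → 𝟙 (p (suc i)) ≡ 0
  none i i<n with p (suc i) in pi
  ... | false = refl
  ... | true  with () ← unique 0 (suc i) z<s (s<s i<n) p0 pi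

𝟙-any-≤ : ∀ (p : ℕ → Bool) f k → 𝟙 (any p (applyUpTo f k)) ≤ ∑< k (𝟙 ∘ p ∘ f)
𝟙-any-≤ p f zero    = z≤n
𝟙-any-≤ p f (suc k) = ≤-trans (𝟙-∨ (p (f 0)) _) (+-monoʳ-≤ (𝟙 (p (f 0))) (𝟙-any-≤ p (f ∘ suc) k))

∑<-truncate : ∀ n {v} f → v ≤ n → ∑< n (λ u → 𝟙 (u <ᵇ v) * f u) ≡ ∑< v f
∑<-truncate n {v} f v≤n = begin
  ∑< n (λ u → 𝟙 (u <ᵇ v) * f u)
    ≡⟨ cong (λ l → ∑< l (λ u → 𝟙 (u <ᵇ v) * f u)) (m+[n∸m]≡n v≤n) ⟨
  ∑< (v + (n ∸ v)) (λ u → 𝟙 (u <ᵇ v) * f u)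
    ≡⟨ ∑<-+ v (n ∸ v) _ ⟩
  ∑< v (λ u → 𝟙 (u <ᵇ v) * f u) + ∑< (n ∸ v) (λ i → 𝟙 (v + i <ᵇ v) * f (v + i))
    ≡⟨ cong₂ _+_ (∑<-cong v (λ u u<v → cong (λ b → 𝟙 b * f u) (<ᵇ-true u<v)))
                 (∑<-zero (n ∸ v) (λ i _ → cong (λ b → 𝟙 b * f (v + i)) (<ᵇ-false (m≤m+n v i)))) ⟩
  ∑< v (λ u → 1 * f u) + 0
    ≡⟨ trans (+-identityʳ _) (∑<-cong v (λ u _ → *-identityˡ (f u))) ⟩
  ∑< v f
    ∎
  where open ≡-Reasoning

pathPowerEdges : ℕ → ℕ → ℕ
pathPowerEdges k s = ∑< s (_⊓ k)

-- The v-th vertex of f has exactly (number of earlier vertices of f) ⊓ k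
-- earlier neighbours in the k-th power of the path on f.
∑<-prefix-⊓ : ∀ k f M → ∑< M (λ v → 𝟙 (f v) * (∑< v (𝟙 ∘ f) ⊓ k)) ≡ pathPowerEdges k (∑< M (𝟙 ∘ f))
∑<-prefix-⊓ k f zero    = refl
∑<-prefix-⊓ k f (suc M) = begin
  ∑< (suc M) (λ v → 𝟙 (f v) * (∑< v (𝟙 ∘ f) ⊓ k))
    ≡⟨ ∑<-suc M _ ⟩
  ∑< M (λ v → 𝟙 (f v) * (∑< v (𝟙 ∘ f) ⊓ k)) + 𝟙 (f M) * (s ⊓ k)
    ≡⟨ cong (_+ 𝟙 (f M) * (s ⊓ k)) (∑<-prefix-⊓ k f M) ⟩
  pathPowerEdges k s + 𝟙 (f M) * (s ⊓ k)
    ≡⟨ step (f M) ⟩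
  pathPowerEdges k (s + 𝟙 (f M))
    ≡⟨ cong (pathPowerEdges k) (∑<-suc M (𝟙 ∘ f)) ⟨
  pathPowerEdges k (∑< (suc M) (𝟙 ∘ f))
    ∎
  where
  open ≡-Reasoning
  s = ∑< M (𝟙 ∘ f)
  step : ∀ b → pathPowerEdges k s + 𝟙 b * (s ⊓ k) ≡ pathPowerEdges k (s + 𝟙 b)
  step true  = begin
    pathPowerEdges k s + (s ⊓ k + 0)  ≡⟨ cong (pathPowerEdges k s +_) (+-identityʳ _) ⟩
    ∑< s (_⊓ k) + s ⊓ k               ≡⟨ ∑<-suc s (_⊓ k) ⟨
    pathPowerEdges k (suc s)          ≡⟨ cong (pathPowerEdges k) (+-comm 1 s) ⟩
    pathPowerEdges k (s + 1)          ∎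
  step false = trans (+-identityʳ _) (cong (pathPowerEdges k) (sym (+-identityʳ s)))

triangle : ∀ k → 2 * ∑< k (k ∸_) ≡ k * suc k
triangle zero    = refl
triangle (suc k) = begin
  2 * (suc k + ∑< k (k ∸_))       ≡⟨ *-distribˡ-+ 2 (suc k) _ ⟩
  2 * suc k + 2 * ∑< k (k ∸_)     ≡⟨ cong (2 * suc k +_) (triangle k) ⟩
  2 * suc k + k * suc k           ≡⟨ *-distribʳ-+ (suc k) 2 k ⟨
  (2 + k) * suc k                 ≡⟨ *-comm (2 + k) (suc k) ⟩
  suc k * suc (suc k)             ∎
  where open ≡-Reasoning

-- The shortfall of pathPowerEdges k s from s * k is ∑ (k ∸ i), at most a triangle number.
2*[s*k]≤2*pathPowerEdges+k*[1+k] : ∀ k s → 2 * (s * k) ≤ 2 * pathPowerEdges k s + k * suc k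
2*[s*k]≤2*pathPowerEdges+k*[1+k] k s = begin
  2 * (s * k)                                      ≤⟨ *-monoʳ-≤ 2 shortfall ⟩
  2 * (pathPowerEdges k s + ∑< k (k ∸_))           ≡⟨ *-distribˡ-+ 2 (pathPowerEdges k s) (∑< k (k ∸_)) ⟩
  2 * pathPowerEdges k s + 2 * ∑< k (k ∸_)         ≡⟨ cong (2 * pathPowerEdges k s +_) (triangle k) ⟩
  2 * pathPowerEdges k s + k * suc k               ∎
  where
  open ≤-Reasoning
  shortfall : s * k ≤ pathPowerEdges k s + ∑< k (k ∸_)
  shortfall = begin
    s * k                                          ≡⟨ ∑<-const s k ⟨
    ∑< s (const k)                                 ≡⟨ ∑<-cong s (λ i _ → m⊓n+n∸m≡n i k) ⟨
    ∑< s (λ i → i ⊓ k + (k ∸ i))                   ≡⟨ ∑<-distrib-+ s (_⊓ k) (k ∸_) ⟩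
    pathPowerEdges k s + ∑< s (k ∸_)               ≤⟨ +-monoʳ-≤ (pathPowerEdges k s) (∑<-monoˡ-≤ (k ∸_) (m≤n+m s k)) ⟩
    pathPowerEdges k s + ∑< (k + s) (k ∸_)         ≡⟨ cong (pathPowerEdges k s +_) (∑<-+ k s (k ∸_)) ⟩
    pathPowerEdges k s + (∑< k (k ∸_) + ∑< s (λ i → k ∸ (k + i)))
        ≡⟨ cong (λ x → pathPowerEdges k s + (∑< k (k ∸_) + x)) (∑<-zero s (λ i _ → m≤n⇒m∸n≡0 (m≤m+n k i))) ⟩
    pathPowerEdges k s + (∑< k (k ∸_) + 0)         ≡⟨ cong (pathPowerEdges k s +_) (+-identityʳ _) ⟩
    pathPowerEdges k s + ∑< k (k ∸_)               ∎

module Cycle (n : ℕ) .{{_ : NonZero n}} where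

  infixl 6 _⊕_
  _⊕_ : ℕ → ℕ → ℕ
  x ⊕ c = (x + c) % n

  [a%n+b]%n≡[a+b]%n : ∀ a b → (a % n + b) % n ≡ (a + b) % n
  [a%n+b]%n≡[a+b]%n a b = begin
    (a % n + b) % n          ≡⟨ %-distribˡ-+ (a % n) b n ⟩
    (a % n % n + b % n) % n  ≡⟨ cong (λ x → (x + b % n) % n) (m%n%n≡m%n a n) ⟩
    (a % n + b % n) % n      ≡⟨ %-distribˡ-+ a b n ⟨
    (a + b) % n              ∎
    where open ≡-Reasoning

  ⊕-assoc : ∀ x a b → x ⊕ a ⊕ b ≡ x ⊕ (a + b)
  ⊕-assoc x a b = trans ([a%n+b]%n≡[a+b]%n (x + a) b) (cong (_% n) (+-assoc x a b))

  ⊕-comm : ∀ x a b → x ⊕ a ⊕ b ≡ x ⊕ b ⊕ a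
  ⊕-comm x a b = trans (⊕-assoc x a b) (trans (cong (x ⊕_) (+-comm a b)) (sym (⊕-assoc x b a)))

  ⊕-%ʳ : ∀ x c → x ⊕ c % n ≡ x ⊕ c
  ⊕-%ʳ x c = begin
    (x + c % n) % n  ≡⟨ cong (_% n) (+-comm x (c % n)) ⟩
    (c % n + x) % n  ≡⟨ [a%n+b]%n≡[a+b]%n c x ⟩
    (c + x) % n      ≡⟨ cong (_% n) (+-comm c x) ⟩
    (x + c) % n      ∎
    where open ≡-Reasoning

  ⊕-inverse : ∀ x c → x ⊕ c ⊕ pred n * c ≡ x % n
  ⊕-inverse x c = begin
    x ⊕ c ⊕ pred n * c        ≡⟨ ⊕-assoc x c (pred n * c) ⟩
    x ⊕ suc (pred n) * c      ≡⟨ cong (λ y → x ⊕ y * c) (suc-pred n) ⟩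
    (x + n * c) % n           ≡⟨ cong (λ y → (x + y) % n) (*-comm n c) ⟩
    (x + c * n) % n           ≡⟨ [m+kn]%n≡m%n x c n ⟩
    x % n                     ∎
    where open ≡-Reasoning

  ⊕-cancelʳ : ∀ {x y} c → x < n → y < n → x ⊕ c ≡ y ⊕ c → x ≡ y
  ⊕-cancelʳ {x} {y} c x<n y<n eq = begin
    x                   ≡⟨ m<n⇒m%n≡m x<n ⟨
    x % n               ≡⟨ ⊕-inverse x c ⟨
    x ⊕ c ⊕ pred n * c  ≡⟨ cong (_⊕ pred n * c) eq ⟩
    y ⊕ c ⊕ pred n * c  ≡⟨ ⊕-inverse y c ⟩
    y % n               ≡⟨ m<n⇒m%n≡m y<n ⟩
    y                   ∎
    where open ≡-Reasoning

  ⊕-no-fixpoint : ∀ {d u} → suc d < n → u < n → u ⊕ suc d ≢ u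
  ⊕-no-fixpoint {d} {u} d<n u<n e = 0≢1+n (sym (⊕-cancelʳ u d<n (>-nonZero⁻¹ n)
    (trans (cong (_% n) (+-comm (suc d) u)) (trans e (sym (m<n⇒m%n≡m u<n))))))

  ∑<-rotate : ∀ c f → ∑< n (λ x → f (x ⊕ c)) ≡ ∑< n f
  ∑<-rotate c f = begin
    ∑< n (λ x → f (x ⊕ c))                          ≡⟨ ∑<-cong n (λ x _ → cong f (sym (⊕-%ʳ x c))) ⟩
    ∑< n (f ∘ (_⊕ r))                               ≡⟨ cong (λ l → ∑< l (f ∘ (_⊕ r))) (sym (m∸n+n≡m r≤n)) ⟩
    ∑< (n ∸ r + r) (f ∘ (_⊕ r))                     ≡⟨ ∑<-+ (n ∸ r) r (f ∘ (_⊕ r)) ⟩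
    ∑< (n ∸ r) (λ x → f (x ⊕ r)) + ∑< r (λ x → f (n ∸ r + x ⊕ r))
                                                    ≡⟨ cong₂ _+_ (∑<-cong (n ∸ r) unwrapped) (∑<-cong r wrapped) ⟩
    ∑< (n ∸ r) (λ x → f (r + x)) + ∑< r f           ≡⟨ +-comm _ (∑< r f) ⟩
    ∑< r f + ∑< (n ∸ r) (λ x → f (r + x))           ≡⟨ ∑<-+ r (n ∸ r) f ⟨
    ∑< (r + (n ∸ r)) f                              ≡⟨ cong (λ l → ∑< l f) (m+[n∸m]≡n r≤n) ⟩
    ∑< n f                                          ∎
    where
    open ≡-Reasoning
    r = c % n
    r≤n : r ≤ n
    r≤n = m%n≤n c n
    unwrapped : ∀ x → x < n ∸ r → f (x ⊕ r) ≡ f (r + x)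
    unwrapped x x<n∸r = cong f (trans (m<n⇒m%n≡m x+r<n) (+-comm x r))
      where
      x+r<n : x + r < n
      x+r<n = subst (x + r <_) (m∸n+n≡m r≤n) (+-monoˡ-< r x<n∸r)
    wrapped : ∀ x → x < r → f (n ∸ r + x ⊕ r) ≡ f x
    wrapped x x<r = cong f (begin
      (n ∸ r + x + r) % n   ≡⟨ cong (_% n) (trans (xy∙z≈y∙xz (n ∸ r) x r) (cong (x +_) (m∸n+n≡m r≤n))) ⟩
      (x + n) % n           ≡⟨ [m+n]%n≡m%n x n ⟩
      x % n                 ≡⟨ m<n⇒m%n≡m (<-≤-trans x<r r≤n) ⟩
      x                     ∎)

module PowerOfCycle (n k : ℕ) .{{_ : NonZero n}} where

  open Cycle n public

  adj : ℕ → ℕ → Bool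
  adj u v = any (λ i → (u ⊕ i ≡ᵇ v) ∨ (v ⊕ i ≡ᵇ u)) (map suc (upTo k))

  data Linked (j u v : ℕ) : Set where
    ahead  : u ⊕ suc j ≡ v → Linked j u v
    behind : v ⊕ suc j ≡ u → Linked j u v

  adj-applyUpTo : ∀ u v → adj u v ≡ any (λ i → (u ⊕ i ≡ᵇ v) ∨ (v ⊕ i ≡ᵇ u)) (applyUpTo suc k)
  adj-applyUpTo u v = cong (any _) (map-applyUpTo id suc k)

  adj⇒linked : ∀ u v → adj u v ≡ true → ∃[ j ] j < k × Linked j u v
  adj⇒linked u v uv with applyUpTo⁻ suc (any⁻ _ _ (subst T (adj-applyUpTo u v) (Equivalence.from T-≡ uv)))
  ... | j , j<k , t with Equivalence.to T-∨ t
  ...   | inj₁ t₁ = j , j<k , ahead (≡ᵇ⇒≡ _ _ t₁)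
  ...   | inj₂ t₂ = j , j<k , behind (≡ᵇ⇒≡ _ _ t₂)

  linked⇒adj : ∀ {j u v} → j < k → Linked j u v → adj u v ≡ true
  linked⇒adj {j} {u} {v} j<k link = Equivalence.to T-≡
    (subst T (sym (adj-applyUpTo u v)) (any⁺ _ (applyUpTo⁺ suc (Equivalence.from T-∨ (step link)) j<k)))
    where
    step : Linked j u v → T (u ⊕ suc j ≡ᵇ v) ⊎ T (v ⊕ suc j ≡ᵇ u)
    step (ahead e)  = inj₁ (≡⇒≡ᵇ _ _ e)
    step (behind e) = inj₂ (≡⇒≡ᵇ _ _ e)

  adj-sym : ∀ u v → adj u v ≡ adj v u
  adj-sym u v = ⇔→≡ (mk⇔ (flip u v) (flip v u))
    where
    flip : ∀ u v → adj u v ≡ true → adj v u ≡ true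
    flip u v uv with adj⇒linked u v uv
    ... | j , j<k , ahead e  = linked⇒adj j<k (behind e)
    ... | j , j<k , behind e = linked⇒adj j<k (ahead e)

  adj-irrefl : k < n → ∀ {u} → u < n → adj u u ≡ false
  adj-irrefl k<n {u} u<n with adj u u in uu
  ... | false = refl
  ... | true with adj⇒linked u u uu
  ...   | j , j<k , ahead e  = ⊥-elim (⊕-no-fixpoint (≤-<-trans j<k k<n) u<n e)
  ...   | j , j<k , behind e = ⊥-elim (⊕-no-fixpoint (≤-<-trans j<k k<n) u<n e)

  adj-rotate : ∀ c {u v} → u < n → v < n → adj (u ⊕ c) (v ⊕ c) ≡ adj u v
  adj-rotate c {u} {v} u<n v<n = ⇔→≡ (mk⇔ backward (forward c u v))
    where
    forward : ∀ c u v → adj u v ≡ true → adj (u ⊕ c) (v ⊕ c) ≡ true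
    forward c u v uv with adj⇒linked u v uv
    ... | j , j<k , ahead e  = linked⇒adj j<k (ahead (trans (⊕-comm u c (suc j)) (cong (_⊕ c) e)))
    ... | j , j<k , behind e = linked⇒adj j<k (behind (trans (⊕-comm v c (suc j)) (cong (_⊕ c) e)))
    backward : adj (u ⊕ c) (v ⊕ c) ≡ true → adj u v ≡ true
    backward uv = subst₂ (λ a b → adj a b ≡ true)
      (trans (⊕-inverse u c) (m<n⇒m%n≡m u<n)) (trans (⊕-inverse v c) (m<n⇒m%n≡m v<n))
      (forward (pred n * c) (u ⊕ c) (v ⊕ c) uv)

  deg : ℕ → ℕ
  deg u = ∑< n (𝟙 ∘ adj u)

  deg≡deg0 : ∀ {u} → u < n → deg u ≡ deg 0
  deg≡deg0 {u} u<n = begin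
    ∑< n (λ v → 𝟙 (adj u v))            ≡⟨ ∑<-rotate u (𝟙 ∘ adj u) ⟨
    ∑< n (λ v → 𝟙 (adj u (v ⊕ u)))      ≡⟨ ∑<-cong n (λ v v<n → cong 𝟙 (trans (cong (λ w → adj w (v ⊕ u)) u≡0⊕u)
                                                                          (adj-rotate u (>-nonZero⁻¹ n) v<n))) ⟩
    ∑< n (λ v → 𝟙 (adj 0 v))            ∎
    where
    open ≡-Reasoning
    u≡0⊕u : u ≡ 0 ⊕ u
    u≡0⊕u = sym (m<n⇒m%n≡m u<n)

  deg≤2k : ∀ u → deg u ≤ 2 * k
  deg≤2k u = begin
    ∑< n (λ v → 𝟙 (adj u v))                               ≤⟨ ∑<-mono-≤ n (λ v _ → 𝟙-adj-≤ v) ⟩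
    ∑< n (λ v → ∑< k (λ j → 𝟙 (out j v) + 𝟙 (in′ j v)))      ≡⟨ ∑<-comm n k (λ v j → 𝟙 (out j v) + 𝟙 (in′ j v)) ⟩
    ∑< k (λ j → ∑< n (λ v → 𝟙 (out j v) + 𝟙 (in′ j v)))      ≡⟨ ∑<-cong k (λ j _ → ∑<-distrib-+ n (𝟙 ∘ out j) (𝟙 ∘ in′ j)) ⟩
    ∑< k (λ j → ∑< n (𝟙 ∘ out j) + ∑< n (𝟙 ∘ in′ j))         ≤⟨ ∑<-≤-const k 2 (λ j _ →
                                                                +-mono-≤ (∑<-𝟙-≤1 n (out j) (out-unique j)) (∑<-𝟙-≤1 n (in′ j) (in-unique j))) ⟩
    k * 2                                                  ≡⟨ *-comm k 2 ⟩
    2 * k                                                  ∎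
    where
    open ≤-Reasoning
    out in′ : ℕ → ℕ → Bool
    out j v = u ⊕ suc j ≡ᵇ v
    in′ j v = v ⊕ suc j ≡ᵇ u
    𝟙-adj-≤ : ∀ v → 𝟙 (adj u v) ≤ ∑< k (λ j → 𝟙 (out j v) + 𝟙 (in′ j v))
    𝟙-adj-≤ v = begin
      𝟙 (adj u v)                                          ≡⟨ cong 𝟙 (adj-applyUpTo u v) ⟩
      𝟙 (any (λ i → (u ⊕ i ≡ᵇ v) ∨ (v ⊕ i ≡ᵇ u)) (applyUpTo suc k)) ≤⟨ 𝟙-any-≤ _ suc k ⟩
      ∑< k (λ j → 𝟙 (out j v ∨ in′ j v))                    ≤⟨ ∑<-mono-≤ k (λ j _ → 𝟙-∨ (out j v) (in′ j v)) ⟩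
      ∑< k (λ j → 𝟙 (out j v) + 𝟙 (in′ j v))               ∎
    out-unique : ∀ j v w → v < n → w < n → out j v ≡ true → out j w ≡ true → v ≡ w
    out-unique j v w _ _ uv uw = trans (sym (≡ᵇ-true⇒≡ (u ⊕ suc j) v uv)) (≡ᵇ-true⇒≡ (u ⊕ suc j) w uw)
    in-unique : ∀ j v w → v < n → w < n → in′ j v ≡ true → in′ j w ≡ true → v ≡ w
    in-unique j v w v<n w<n vu wu =
      ⊕-cancelʳ (suc j) v<n w<n (trans (≡ᵇ-true⇒≡ (v ⊕ suc j) u vu) (sym (≡ᵇ-true⇒≡ (w ⊕ suc j) u wu)))

  #pairs : (ℕ → ℕ → Bool) → ℕ
  #pairs P = ∑< n (λ u → ∑< n (λ v → 𝟙 (P u v)))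

  #pairs-cong : ∀ {P Q} → (∀ u v → u < n → v < n → P u v ≡ Q u v) → #pairs P ≡ #pairs Q
  #pairs-cong P≡Q = ∑<-cong n (λ u u<n → ∑<-cong n (λ v v<n → cong 𝟙 (P≡Q u v u<n v<n)))

  #pairs-mono : ∀ {P Q} → (∀ u v → u < n → v < n → P u v ≡ true → Q u v ≡ true) → #pairs P ≤ #pairs Q
  #pairs-mono P⇒Q = ∑<-mono-≤ n (λ u u<n → ∑<-mono-≤ n (λ v v<n → 𝟙-mono (P⇒Q u v u<n v<n)))

  #pairs-transpose : ∀ P → #pairs P ≡ #pairs (λ u v → P v u)
  #pairs-transpose P = ∑<-comm n n (λ u v → 𝟙 (P u v))

  #pairs-halve : ∀ P → (∀ u v → P u v ≡ P v u) → (∀ u → u < n → P u u ≡ false) →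
                 #pairs P ≡ 2 * #pairs (λ u v → (u <ᵇ v) ∧ P u v)
  #pairs-halve P sym-P irrefl-P = begin
    #pairs P
      ≡⟨ ∑<-cong n (λ u u<n → trans (∑<-cong n (λ v v<n → split u v u<n))
                                    (∑<-distrib-+ n (λ v → 𝟙 ((u <ᵇ v) ∧ P u v)) (λ v → 𝟙 ((v <ᵇ u) ∧ P u v)))) ⟩
    ∑< n (λ u → ∑< n (λ v → 𝟙 ((u <ᵇ v) ∧ P u v)) + ∑< n (λ v → 𝟙 ((v <ᵇ u) ∧ P u v)))
      ≡⟨ ∑<-distrib-+ n (λ u → ∑< n (λ v → 𝟙 (P< u v))) (λ u → ∑< n (λ v → 𝟙 ((v <ᵇ u) ∧ P u v))) ⟩
    #pairs P< + #pairs (λ u v → (v <ᵇ u) ∧ P u v)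
      ≡⟨ cong (#pairs P< +_) (trans (#pairs-transpose (λ u v → (v <ᵇ u) ∧ P u v))
                                    (#pairs-cong (λ u v _ _ → cong ((u <ᵇ v) ∧_) (sym-P v u)))) ⟩
    #pairs P< + #pairs P<
      ≡⟨ cong (#pairs P< +_) (+-identityʳ (#pairs P<)) ⟨
    2 * #pairs P<
      ∎
    where
    open ≡-Reasoning
    P< : ℕ → ℕ → Bool
    P< u v = (u <ᵇ v) ∧ P u v
    split : ∀ u v → u < n → 𝟙 (P u v) ≡ 𝟙 (P< u v) + 𝟙 ((v <ᵇ u) ∧ P u v)
    split u v u<n with <-cmp u v
    ... | tri< u<v _ _ rewrite <ᵇ-true u<v | <ᵇ-false (<⇒≤ u<v) = sym (+-identityʳ _)
    ... | tri> _ _ v<u rewrite <ᵇ-true v<u | <ᵇ-false (<⇒≤ v<u) = refl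
    ... | tri≈ _ refl _ rewrite irrefl-P u u<n | <ᵇ-false {u} ≤-refl = refl

  -- A vertex set is a predicate on ℕ; only its values below n are ever inspected.
  size : (ℕ → Bool) → ℕ
  size f = ∑< n (𝟙 ∘ f)

  pairs : (ℕ → Bool) → (ℕ → Bool) → ℕ
  pairs f g = #pairs (λ u v → f u ∧ g v ∧ adj u v)

  edges : (ℕ → Bool) → ℕ
  edges f = #pairs (λ u v → (u <ᵇ v) ∧ f u ∧ f v ∧ adj u v)

  size-rotate : ∀ c f → size (f ∘ (_⊕ c)) ≡ size f
  size-rotate c f = ∑<-rotate c (𝟙 ∘ f)

  size≤n : ∀ f → size f ≤ n
  size≤n f = ≤-trans (∑<-≤-const n 1 (λ x _ → 𝟙≤1 (f x))) (≤-reflexive (*-identityʳ n))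

  size+size-not : ∀ f → size f + size (not ∘ f) ≡ n
  size+size-not f = begin
    size f + size (not ∘ f)                 ≡⟨ ∑<-distrib-+ n (𝟙 ∘ f) (𝟙 ∘ not ∘ f) ⟨
    ∑< n (λ x → 𝟙 (f x) + 𝟙 (not (f x)))    ≡⟨ ∑<-cong n (λ x _ → 𝟙+𝟙-not (f x)) ⟩
    ∑< n (const 1)                          ≡⟨ ∑<-const n 1 ⟩
    n * 1                                   ≡⟨ *-identityʳ n ⟩
    n                                       ∎
    where open ≡-Reasoning

  ∧-adj-swap : ∀ (f g : ℕ → Bool) u v → f u ∧ g v ∧ adj u v ≡ g v ∧ f u ∧ adj v u
  ∧-adj-swap f g u v with f u | g v
  ... | true  | true  = adj-sym u v
  ... | true  | false = refl
  ... | false | true  = refl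
  ... | false | false = refl

  pairs-cong : ∀ {f f′ g g′} → (∀ x → x < n → f x ≡ f′ x) → (∀ x → x < n → g x ≡ g′ x) → pairs f g ≡ pairs f′ g′
  pairs-cong f≡f′ g≡g′ = #pairs-cong (λ u v u<n v<n → cong₂ (λ a b → a ∧ b ∧ adj u v) (f≡f′ u u<n) (g≡g′ v v<n))

  pairs-sym : ∀ f g → pairs f g ≡ pairs g f
  pairs-sym f g = trans (#pairs-transpose _) (#pairs-cong (λ u v _ _ → ∧-adj-swap f g v u))

  pairs-rotate : ∀ c f g → pairs (f ∘ (_⊕ c)) (g ∘ (_⊕ c)) ≡ pairs f g
  pairs-rotate c f g = begin
    ∑< n (λ u → ∑< n (λ v → 𝟙 (f (u ⊕ c) ∧ g (v ⊕ c) ∧ adj u v)))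
      ≡⟨ ∑<-cong n (λ u u<n → ∑<-cong n (λ v v<n →
           cong (λ b → 𝟙 (f (u ⊕ c) ∧ g (v ⊕ c) ∧ b)) (sym (adj-rotate c u<n v<n)))) ⟩
    ∑< n (λ u → ∑< n (λ v → 𝟙 (f (u ⊕ c) ∧ g (v ⊕ c) ∧ adj (u ⊕ c) (v ⊕ c))))
      ≡⟨ ∑<-cong n (λ u _ → ∑<-rotate c (λ w → 𝟙 (f (u ⊕ c) ∧ g w ∧ adj (u ⊕ c) w))) ⟩
    ∑< n (λ u → ∑< n (λ v → 𝟙 (f (u ⊕ c) ∧ g v ∧ adj (u ⊕ c) v)))
      ≡⟨ ∑<-rotate c (λ w → ∑< n (λ v → 𝟙 (f w ∧ g v ∧ adj w v))) ⟩
    pairs f g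
      ∎
    where open ≡-Reasoning

  pairs+pairs-not : ∀ f g h → (∀ x → h x ≡ not (g x)) → pairs f g + pairs f h ≡ size f * deg 0
  pairs+pairs-not f g h h≡¬g = begin
    pairs f g + pairs f h
      ≡⟨ ∑<-distrib-+ n _ _ ⟨
    ∑< n (λ u → ∑< n (λ v → 𝟙 (f u ∧ g v ∧ adj u v)) + ∑< n (λ v → 𝟙 (f u ∧ h v ∧ adj u v)))
      ≡⟨ ∑<-cong n (λ u _ → trans (sym (∑<-distrib-+ n (λ v → 𝟙 (f u ∧ g v ∧ adj u v))
                                                          (λ v → 𝟙 (f u ∧ h v ∧ adj u v))))
                                  (∑<-cong n (λ v _ → one-side u v))) ⟩
    ∑< n (λ u → ∑< n (λ v → 𝟙 (f u) * 𝟙 (adj u v)))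
      ≡⟨ ∑<-cong n (λ u u<n → trans (∑<-distribˡ-* n (𝟙 (f u)) (𝟙 ∘ adj u)) (cong (𝟙 (f u) *_) (deg≡deg0 u<n))) ⟩
    ∑< n (λ u → 𝟙 (f u) * deg 0)
      ≡⟨ ∑<-distribʳ-* n (deg 0) (𝟙 ∘ f) ⟩
    size f * deg 0
      ∎
    where
    open ≡-Reasoning
    one-side : ∀ u v → 𝟙 (f u ∧ g v ∧ adj u v) + 𝟙 (f u ∧ h v ∧ adj u v) ≡ 𝟙 (f u) * 𝟙 (adj u v)
    one-side u v rewrite h≡¬g v with f u | g v
    ... | false | _     = refl
    ... | true  | true  = refl
    ... | true  | false = sym (+-identityʳ _)

  pairs-complement : ∀ f → pairs f f + size (not ∘ f) * deg 0 ≡ pairs (not ∘ f) (not ∘ f) + size f * deg 0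
  pairs-complement f = begin
    pairs f f + size f̄ * deg 0                 ≡⟨ cong (pairs f f +_) (pairs+pairs-not f̄ f̄ f (sym ∘ not-involutive ∘ f)) ⟨
    pairs f f + (pairs f̄ f̄ + pairs f̄ f)        ≡⟨ cong (λ x → pairs f f + (pairs f̄ f̄ + x)) (pairs-sym f̄ f) ⟩
    pairs f f + (pairs f̄ f̄ + pairs f f̄)        ≡⟨ x∙yz≈y∙xz (pairs f f) (pairs f̄ f̄) (pairs f f̄) ⟩
    pairs f̄ f̄ + (pairs f f + pairs f f̄)        ≡⟨ cong (pairs f̄ f̄ +_) (pairs+pairs-not f f f̄ (λ _ → refl)) ⟩
    pairs f̄ f̄ + size f * deg 0                 ∎
    where
    open ≡-Reasoning
    f̄ = not ∘ f

  backDeg : (ℕ → Bool) → ℕ → ℕ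
  backDeg f v = ∑< v (λ u → 𝟙 (f u ∧ adj u v))

  edges-by-backDeg : ∀ f → edges f ≡ ∑< n (λ v → 𝟙 (f v) * backDeg f v)
  edges-by-backDeg f = begin
    edges f
      ≡⟨ #pairs-transpose _ ⟩
    ∑< n (λ v → ∑< n (λ u → 𝟙 ((u <ᵇ v) ∧ f u ∧ f v ∧ adj u v)))
      ≡⟨ ∑<-cong n (λ v _ → ∑<-cong n (λ u _ → 𝟙-∧-shuffle (u <ᵇ v) (f u) (f v) (adj u v))) ⟩
    ∑< n (λ v → ∑< n (λ u → 𝟙 (f v) * (𝟙 (u <ᵇ v) * 𝟙 (f u ∧ adj u v))))
      ≡⟨ ∑<-cong n (λ v v<n → trans (∑<-distribˡ-* n (𝟙 (f v)) _)
                                    (cong (𝟙 (f v) *_) (∑<-truncate n (λ u → 𝟙 (f u ∧ adj u v)) (<⇒≤ v<n)))) ⟩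
    ∑< n (λ v → 𝟙 (f v) * backDeg f v)
      ∎
    where open ≡-Reasoning

  backDeg≤size-below : ∀ f v → backDeg f v ≤ ∑< v (𝟙 ∘ f)
  backDeg≤size-below f v = ∑<-mono-≤ v (λ u _ → 𝟙-∧-≤ˡ (f u) (adj u v))

  adj-below : ∀ {u v} → u < v → v + k < n → adj u v ≡ true → ∃[ j ] j < k × u + suc j ≡ v
  adj-below {u} {v} u<v v+k<n uv with adj⇒linked u v uv
  ... | j , j<k , ahead e  = j , j<k , trans (sym (m<n⇒m%n≡m u+j<n)) e
    where
    u+j<n : u + suc j < n
    u+j<n = <-≤-trans (+-monoˡ-< (suc j) u<v) (≤-trans (+-monoʳ-≤ v j<k) (<⇒≤ v+k<n))
  ... | j , j<k , behind e = ⊥-elim (<⇒≱ u<v (subst (v ≤_) v+j+1≡u (m≤m+n v (suc j))))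
    where
    v+j+1≡u : v + suc j ≡ u
    v+j+1≡u = trans (sym (m<n⇒m%n≡m (≤-<-trans (+-monoʳ-≤ v j<k) v+k<n))) e

  backDeg≤k : ∀ f {v} → v + k < n → backDeg f v ≤ k
  backDeg≤k f {v} v+k<n = begin
    ∑< v (λ u → 𝟙 (f u ∧ adj u v))               ≤⟨ ∑<-mono-≤ v (λ u u<v → 𝟙-≤-shifts u u<v) ⟩
    ∑< v (λ u → ∑< k (λ j → 𝟙 (u + suc j ≡ᵇ v))) ≡⟨ ∑<-comm v k (λ u j → 𝟙 (u + suc j ≡ᵇ v)) ⟩
    ∑< k (λ j → ∑< v (λ u → 𝟙 (u + suc j ≡ᵇ v))) ≤⟨ ∑<-≤-const k 1 (λ j _ → ∑<-𝟙-≤1 v _ (unique j)) ⟩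
    k * 1                                        ≡⟨ *-identityʳ k ⟩
    k                                            ∎
    where
    open ≤-Reasoning
    𝟙-≤-shifts : ∀ u → u < v → 𝟙 (f u ∧ adj u v) ≤ ∑< k (λ j → 𝟙 (u + suc j ≡ᵇ v))
    𝟙-≤-shifts u u<v with f u | adj u v in uv
    ... | false | _     = z≤n
    ... | true  | false = z≤n
    ... | true  | true with adj-below u<v v+k<n uv
    ...   | j , j<k , e = subst (_≤ ∑< k _) (cong 𝟙 (Equivalence.to T-≡ (≡⇒≡ᵇ _ _ e)))
                                (term≤∑< k (λ j → 𝟙 (u + suc j ≡ᵇ v)) j<k)
    unique : ∀ j u w → u < v → w < v → (u + suc j ≡ᵇ v) ≡ true → (w + suc j ≡ᵇ v) ≡ true → u ≡ w
    unique j u w _ _ uv wv = +-cancelʳ-≡ (suc j) u w (trans (≡ᵇ-true⇒≡ _ v uv) (sym (≡ᵇ-true⇒≡ _ v wv)))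

  edges≤pathPowerEdges : ∀ f → (∀ x → x < n → f x ≡ true → x + k < n) → edges f ≤ pathPowerEdges k (size f)
  edges≤pathPowerEdges f short = begin
    edges f                                            ≡⟨ edges-by-backDeg f ⟩
    ∑< n (λ v → 𝟙 (f v) * backDeg f v)                 ≤⟨ ∑<-mono-≤ n (λ v v<n → 𝟙*-mono (f v) (λ fv →
                                                            ⊓-glb (backDeg≤size-below f v) (backDeg≤k f (short v v<n fv)))) ⟩
    ∑< n (λ v → 𝟙 (f v) * (∑< v (𝟙 ∘ f) ⊓ k))          ≡⟨ ∑<-prefix-⊓ k f n ⟩
    pathPowerEdges k (size f)                          ∎
    where open ≤-Reasoning

  interval : ℕ → ℕ → Bool
  interval s x = x <ᵇ s

  size-interval : ∀ {s} → s ≤ n → size (interval s) ≡ s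
  size-interval {s} s≤n = begin
    ∑< n (λ x → 𝟙 (x <ᵇ s))          ≡⟨ ∑<-cong n (λ x _ → *-identityʳ (𝟙 (x <ᵇ s))) ⟨
    ∑< n (λ x → 𝟙 (x <ᵇ s) * 1)      ≡⟨ ∑<-truncate n (const 1) s≤n ⟩
    ∑< s (const 1)                   ≡⟨ ∑<-const s 1 ⟩
    s * 1                            ≡⟨ *-identityʳ s ⟩
    s                                ∎
    where open ≡-Reasoning

  ⊓k≤backDeg : ∀ g {v} → v < n → (∀ u → u < v → g u ≡ true) → v ⊓ k ≤ backDeg g v
  ⊓k≤backDeg g {v} v<n below = begin
    d                                                   ≡⟨ trans (sym (*-identityʳ d)) (sym (∑<-const d 1)) ⟩
    ∑< d (const 1)                                      ≡⟨ ∑<-cong d (λ x x<d → cong 𝟙 (neighbour x x<d)) ⟨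
    ∑< d (λ x → 𝟙 (g (a + x) ∧ adj (a + x) v))          ≤⟨ m≤n+m _ (∑< a (λ u → 𝟙 (g u ∧ adj u v))) ⟩
    ∑< a (λ u → 𝟙 (g u ∧ adj u v)) + ∑< d (λ x → 𝟙 (g (a + x) ∧ adj (a + x) v))
                                                        ≡⟨ ∑<-+ a d (λ u → 𝟙 (g u ∧ adj u v)) ⟨
    ∑< (a + d) (λ u → 𝟙 (g u ∧ adj u v))                ≡⟨ cong (λ l → ∑< l (λ u → 𝟙 (g u ∧ adj u v))) a+d≡v ⟩
    backDeg g v                                         ∎
    where
    open ≤-Reasoning
    d = v ⊓ k
    a = v ∸ d
    a+d≡v : a + d ≡ v
    a+d≡v = m∸n+n≡m (m⊓n≤m v k)
    neighbour : ∀ x → x < d → g (a + x) ∧ adj (a + x) v ≡ true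
    neighbour x x<d rewrite below (a + x) (subst (a + x <_) a+d≡v (+-monoʳ-< a x<d)) =
      linked⇒adj j<k (ahead (trans (cong (_% n) a+x+[j+1]≡v) (m<n⇒m%n≡m v<n)))
      where
      j = d ∸ suc x
      j+1≡d∸x : suc j ≡ d ∸ x
      j+1≡d∸x = sym (+-∸-assoc 1 x<d)
      j<k : j < k
      j<k = ≤-trans (≤-reflexive j+1≡d∸x) (≤-trans (m∸n≤m d x) (m⊓n≤n v k))
      a+x+[j+1]≡v : a + x + suc j ≡ v
      a+x+[j+1]≡v = begin-equality
        a + x + suc j      ≡⟨ cong (a + x +_) j+1≡d∸x ⟩
        a + x + (d ∸ x)    ≡⟨ +-assoc a x (d ∸ x) ⟩
        a + (x + (d ∸ x))  ≡⟨ cong (a +_) (m+[n∸m]≡n (<⇒≤ x<d)) ⟩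
        a + d              ≡⟨ a+d≡v ⟩
        v                  ∎

  pathPowerEdges≤edges-interval : ∀ {s} → s ≤ n → pathPowerEdges k s ≤ edges (interval s)
  pathPowerEdges≤edges-interval {s} s≤n = begin
    ∑< s (_⊓ k)                                        ≡⟨ ∑<-truncate n (_⊓ k) s≤n ⟨
    ∑< n (λ v → 𝟙 (v <ᵇ s) * (v ⊓ k))                  ≤⟨ ∑<-mono-≤ n (λ v v<n → 𝟙*-mono (v <ᵇ s) (λ v<s →
                                                            ⊓k≤backDeg (interval s) v<n
                                                              (below (<ᵇ⇒< v s (Equivalence.from T-≡ v<s))))) ⟩
    ∑< n (λ v → 𝟙 (v <ᵇ s) * backDeg (interval s) v)   ≡⟨ edges-by-backDeg (interval s) ⟨
    edges (interval s)                                 ∎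
    where
    open ≤-Reasoning
    below : ∀ {v} → v < s → ∀ u → u < v → interval s u ≡ true
    below v<s u u<v = <ᵇ-true (<-trans u<v v<s)

  pairs≡2*edges : k < n → ∀ f → pairs f f ≡ 2 * edges f
  pairs≡2*edges k<n f = #pairs-halve (λ u v → f u ∧ f v ∧ adj u v) (∧-adj-swap f f) irrefl
    where
    irrefl : ∀ u → u < n → f u ∧ f u ∧ adj u u ≡ false
    irrefl u u<n rewrite adj-irrefl k<n u<n with f u
    ... | true  = refl
    ... | false = refl

  2*pathPowerEdges≤pairs-interval : k < n → ∀ {s} → s ≤ n → 2 * pathPowerEdges k s ≤ pairs (interval s) (interval s)
  2*pathPowerEdges≤pairs-interval k<n {s} s≤n =
    subst (2 * pathPowerEdges k s ≤_) (sym (pairs≡2*edges k<n (interval s))) (*-monoʳ-≤ 2 (pathPowerEdges≤edges-interval s≤n))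

  Window : (ℕ → Bool) → Bool → ℕ → Set
  Window f b u = ∀ {j} → j < k → f (u ⊕ suc j) ≡ b

  gap⇒pairs≤2*pathPowerEdges : k < n → ∀ f {u} → Window f false u → pairs f f ≤ 2 * pathPowerEdges k (size f)
  gap⇒pairs≤2*pathPowerEdges k<n f {u} gap = begin
    pairs f f                        ≡⟨ pairs-rotate c f f ⟨
    pairs f′ f′                      ≡⟨ pairs≡2*edges k<n f′ ⟩
    2 * edges f′                     ≤⟨ *-monoʳ-≤ 2 (edges≤pathPowerEdges f′ short) ⟩
    2 * pathPowerEdges k (size f′)   ≡⟨ cong (λ s → 2 * pathPowerEdges k s) (size-rotate c f) ⟩
    2 * pathPowerEdges k (size f)    ∎
    where
    open ≤-Reasoning
    c = u + suc k
    f′ = f ∘ (_⊕ c)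
    wrapped : ∀ x → x < n → n ≤ x + k → f′ x ≡ false
    wrapped x x<n n≤x+k = trans (cong f wraps) (gap j<k)
      where
      j = x + k ∸ n
      j<k : j < k
      j<k = +-cancelʳ-< n j k (subst₂ _<_ (sym (m∸n+n≡m n≤x+k)) (+-comm n k) (+-monoˡ-< k x<n))
      wraps : x ⊕ c ≡ u ⊕ suc j
      wraps = begin-equality
        (x + (u + suc k)) % n   ≡⟨ cong (_% n) (trans (shuffle x u k) (cong (λ y → u + suc y) (sym (m∸n+n≡m n≤x+k)))) ⟩
        (u + suc (j + n)) % n   ≡⟨ cong (_% n) (sym (+-assoc u (suc j) n)) ⟩
        (u + suc j + n) % n     ≡⟨ [m+n]%n≡m%n (u + suc j) n ⟩
        u ⊕ suc j               ∎
        where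
        shuffle : ∀ x u k → x + (u + suc k) ≡ u + suc (x + k)
        shuffle = solve-∀
    short : ∀ x → x < n → f′ x ≡ true → x + k < n
    short x x<n f′x with x + k <? n
    ... | yes x+k<n = x+k<n
    ... | no  x+k≮n with () ← trans (sym f′x) (wrapped x x<n (≮⇒≥ x+k≮n))

  Mixed : (ℕ → Bool) → Set
  Mixed f = ∀ {u} → u < n → ∃[ j ] j < k × f (u ⊕ suc j) ≢ f u

  mixed⇒n≤2*pairs-not : ∀ f → Mixed f → n ≤ 2 * pairs f (not ∘ f)
  mixed⇒n≤2*pairs-not f mixed = begin
    n                                   ≡⟨ trans (sym (*-identityʳ n)) (sym (∑<-const n 1)) ⟩
    ∑< n (const 1)                      ≤⟨ ∑<-mono-≤ n (λ u u<n → ≤-trans (across u<n) (≤-reflexive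
                                             (∑<-distrib-+ n (λ v → 𝟙 (f u ∧ f̄ v ∧ adj u v))
                                                             (λ v → 𝟙 (f̄ u ∧ f v ∧ adj u v))))) ⟩
    ∑< n (λ u → ∑< n (λ v → 𝟙 (f u ∧ f̄ v ∧ adj u v)) + ∑< n (λ v → 𝟙 (f̄ u ∧ f v ∧ adj u v)))
                                        ≡⟨ ∑<-distrib-+ n _ _ ⟩
    pairs f f̄ + pairs f̄ f               ≡⟨ cong (pairs f f̄ +_) (pairs-sym f̄ f) ⟩
    pairs f f̄ + pairs f f̄               ≡⟨ cong (pairs f f̄ +_) (+-identityʳ _) ⟨
    2 * pairs f f̄                       ∎
    where
    open ≤-Reasoning
    f̄ = not ∘ f
    differ : ∀ a b c → b ≢ a → c ≡ true → 1 ≤ 𝟙 (a ∧ not b ∧ c) + 𝟙 (not a ∧ b ∧ c)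
    differ true  false _ _  refl = ≤-refl
    differ false true  _ _  refl = ≤-refl
    differ true  true  _ ne _    = ⊥-elim (ne refl)
    differ false false _ ne _    = ⊥-elim (ne refl)
    across : ∀ {u} → u < n → 1 ≤ ∑< n (λ v → 𝟙 (f u ∧ f̄ v ∧ adj u v) + 𝟙 (f̄ u ∧ f v ∧ adj u v))
    across {u} u<n with mixed u<n
    ... | j , j<k , ne = ≤-trans (differ (f u) (f w) (adj u w) ne (linked⇒adj j<k (ahead refl)))
                                 (term≤∑< n (λ v → 𝟙 (f u ∧ f̄ v ∧ adj u v) + 𝟙 (f̄ u ∧ f v ∧ adj u v))
                                           (m%n<n (u + suc j) n))
      where w = u ⊕ suc j

  mixed⇒pairs≤2*pathPowerEdges : 2 * k * suc k ≤ n → ∀ f → Mixed f → pairs f f ≤ 2 * pathPowerEdges k (size f)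
  mixed⇒pairs≤2*pathPowerEdges big f mixed = *-cancelˡ-≤ 2 (+-cancelʳ-≤ n _ _ (begin
    2 * pairs f f + n                          ≤⟨ +-monoʳ-≤ (2 * pairs f f) (mixed⇒n≤2*pairs-not f mixed) ⟩
    2 * pairs f f + 2 * pairs f (not ∘ f)      ≡⟨ *-distribˡ-+ 2 (pairs f f) _ ⟨
    2 * (pairs f f + pairs f (not ∘ f))        ≡⟨ cong (2 *_) (pairs+pairs-not f f (not ∘ f) (λ _ → refl)) ⟩
    2 * (s * deg 0)                            ≤⟨ *-monoʳ-≤ 2 (*-monoʳ-≤ s (deg≤2k 0)) ⟩
    2 * (s * (2 * k))                          ≡⟨ cong (2 *_) (s*[2*k]≡2*[s*k] s k) ⟩
    2 * (2 * (s * k))                          ≤⟨ *-monoʳ-≤ 2 (2*[s*k]≤2*pathPowerEdges+k*[1+k] k s) ⟩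
    2 * (2 * L + k * suc k)                    ≡⟨ *-distribˡ-+ 2 (2 * L) (k * suc k) ⟩
    2 * (2 * L) + 2 * (k * suc k)              ≡⟨ cong (2 * (2 * L) +_) (*-assoc 2 k (suc k)) ⟨
    2 * (2 * L) + 2 * k * suc k                ≤⟨ +-monoʳ-≤ (2 * (2 * L)) big ⟩
    2 * (2 * L) + n                            ∎))
    where
    open ≤-Reasoning
    s = size f
    L = pathPowerEdges k s
    s*[2*k]≡2*[s*k] : ∀ s k → s * (2 * k) ≡ 2 * (s * k)
    s*[2*k]≡2*[s*k] = solve-∀

  not-interval-rotate : ∀ {s t} → s + t ≡ n → ∀ {x} → x < n → not (interval s (x ⊕ s)) ≡ interval t x
  not-interval-rotate {s} {t} s+t≡n {x} x<n with x <? t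
  ... | yes x<t = begin
    not ((x + s) % n <ᵇ s)   ≡⟨ cong (λ y → not (y <ᵇ s)) (m<n⇒m%n≡m x+s<n) ⟩
    not (x + s <ᵇ s)         ≡⟨ cong not (<ᵇ-false (m≤n+m s x)) ⟩
    true                     ≡⟨ <ᵇ-true x<t ⟨
    x <ᵇ t                   ∎
    where
    open ≡-Reasoning
    x+s<n : x + s < n
    x+s<n = subst (x + s <_) (trans (+-comm t s) s+t≡n) (+-monoˡ-< s x<t)
  ... | no  x≮t = begin
    not ((x + s) % n <ᵇ s)       ≡⟨ cong (λ y → not (y <ᵇ s)) (trans (sym (m≤n⇒[n∸m]%m≡n%m n≤x+s))
                                                                    (m<n⇒m%n≡m (<-≤-trans wrapped<s s≤n))) ⟩
    not (x + s ∸ n <ᵇ s)         ≡⟨ cong not (<ᵇ-true wrapped<s) ⟩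
    false                        ≡⟨ <ᵇ-false (≮⇒≥ x≮t) ⟨
    x <ᵇ t                       ∎
    where
    open ≡-Reasoning
    s≤n : s ≤ n
    s≤n = subst (s ≤_) s+t≡n (m≤m+n s t)
    n≤x+s : n ≤ x + s
    n≤x+s = subst (_≤ x + s) (trans (+-comm t s) s+t≡n) (+-monoˡ-≤ s (≮⇒≥ x≮t))
    wrapped<s : x + s ∸ n < s
    wrapped<s = +-cancelʳ-< n _ s (subst₂ _<_ (sym (m∸n+n≡m n≤x+s)) (+-comm n s) (+-monoˡ-< s x<n))

  full⇒pairs≤pairs-interval : k < n → ∀ f {u} → Window f true u →
                              pairs f f ≤ pairs (interval (size f)) (interval (size f))
  full⇒pairs≤pairs-interval k<n f {u} full = +-cancelʳ-≤ (t * deg 0) _ _ (begin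
    pairs f f + t * deg 0                                  ≡⟨ pairs-complement f ⟩
    pairs f̄ f̄ + s * deg 0                                  ≤⟨ +-monoˡ-≤ (s * deg 0)
                                                               (gap⇒pairs≤2*pathPowerEdges k<n f̄ (λ j<k → cong not (full j<k))) ⟩
    2 * pathPowerEdges k t + s * deg 0                     ≤⟨ +-monoˡ-≤ (s * deg 0) (2*pathPowerEdges≤pairs-interval k<n t≤n) ⟩
    pairs (interval t) (interval t) + s * deg 0            ≡⟨ cong (_+ s * deg 0) (pairs-cong rotated rotated) ⟨
    pairs (Ī ∘ (_⊕ s)) (Ī ∘ (_⊕ s)) + s * deg 0            ≡⟨ cong (_+ s * deg 0) (pairs-rotate s Ī Ī) ⟩
    pairs Ī Ī + s * deg 0                                  ≡⟨ cong (λ x → pairs Ī Ī + x * deg 0) (size-interval s≤n) ⟨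
    pairs Ī Ī + size I * deg 0                             ≡⟨ pairs-complement I ⟨
    pairs I I + size Ī * deg 0                             ≡⟨ cong (λ x → pairs I I + x * deg 0) size-Ī ⟩
    pairs I I + t * deg 0                                  ∎)
    where
    open ≤-Reasoning
    f̄ = not ∘ f
    s = size f
    t = size f̄
    I = interval s
    Ī = not ∘ I
    s+t≡n : s + t ≡ n
    s+t≡n = size+size-not f
    s≤n = size≤n f
    t≤n = size≤n f̄
    rotated : ∀ x → x < n → not (I (x ⊕ s)) ≡ interval t x
    rotated x x<n = not-interval-rotate {s} {t} s+t≡n x<n
    size-Ī : size Ī ≡ t
    size-Ī = +-cancelˡ-≡ s _ _
      (trans (cong (_+ size Ī) (sym (size-interval s≤n))) (trans (size+size-not I) (sym s+t≡n)))

  window-or-mixed : ∀ f → (∃[ u ] Window f (f u) u) ⊎ Mixed f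
  window-or-mixed f with anyUpTo? (λ u → allUpTo? (λ j → f (u ⊕ suc j) Bool.≟ f u) k) n
  ... | yes (u , _ , window) = inj₁ (u , window)
  ... | no  no-window        = inj₂ mixed
    where
    mixed : Mixed f
    mixed {u} u<n with anyUpTo? (λ j → ¬? (f (u ⊕ suc j) Bool.≟ f u)) k
    ... | yes witness = witness
    ... | no  none    = ⊥-elim (no-window (u , u<n , λ {j} j<k →
                          decidable-stable (f (u ⊕ suc j) Bool.≟ f u) (λ ne → none (j , j<k , ne))))

  pairs≤pairs-interval : k < n → 2 * k * suc k ≤ n → ∀ f →
                         pairs f f ≤ pairs (interval (size f)) (interval (size f))
  pairs≤pairs-interval k<n big f with window-or-mixed f
  ... | inj₂ mixed        = ≤-trans (mixed⇒pairs≤2*pathPowerEdges big f mixed)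
                                    (2*pathPowerEdges≤pairs-interval k<n (size≤n f))
  ... | inj₁ (u , window) = by-colour (f u) window
    where
    by-colour : ∀ b → Window f b u → pairs f f ≤ pairs (interval (size f)) (interval (size f))
    by-colour true  full = full⇒pairs≤pairs-interval k<n f full
    by-colour false gap  = ≤-trans (gap⇒pairs≤2*pathPowerEdges k<n f gap)
                                   (2*pathPowerEdges≤pairs-interval k<n (size≤n f))

  edges≤edges-interval : k < n → 2 * k * suc k ≤ n → ∀ f → edges f ≤ edges (interval (size f))
  edges≤edges-interval k<n big f = *-cancelˡ-≤ 2 (subst₂ _≤_
    (pairs≡2*edges k<n f) (pairs≡2*edges k<n (interval (size f))) (pairs≤pairs-interval k<n big f))

memberℕ : ∀ {n} → Subset n → ℕ → Bool
memberℕ []       _       = false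
memberℕ (b ∷ bs) zero    = b
memberℕ (b ∷ bs) (suc x) = memberℕ bs x

lookup≡memberℕ : ∀ {n} (S : Subset n) i → lookup S i ≡ memberℕ S (toℕ i)
lookup≡memberℕ (b ∷ S) zero    = refl
lookup≡memberℕ (b ∷ S) (suc i) = lookup≡memberℕ S i

∣S∣≡∑<memberℕ : ∀ {n} (S : Subset n) → ∣ S ∣ ≡ ∑< n (𝟙 ∘ memberℕ S)
∣S∣≡∑<memberℕ []        = refl
∣S∣≡∑<memberℕ (true ∷ S)  = cong suc (∣S∣≡∑<memberℕ S)
∣S∣≡∑<memberℕ (false ∷ S) = ∣S∣≡∑<memberℕ S

sum-map-mono-≤ : ∀ {A : Set} (xs : List A) {f g : A → ℕ} → (∀ x → f x ≤ g x) → sum (map f xs) ≤ sum (map g xs)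
sum-map-mono-≤ []       f≤g = z≤n
sum-map-mono-≤ (x ∷ xs) f≤g = +-mono-≤ (f≤g x) (sum-map-mono-≤ xs f≤g)

sum-tabulate : ∀ n (g : Fin n → ℕ) G → (∀ i → g i ≡ G (toℕ i)) → sum (tabulate g) ≡ ∑< n G
sum-tabulate zero    g G g≡G = refl
sum-tabulate (suc n) g G g≡G = cong₂ _+_ (g≡G zero) (sum-tabulate n (g ∘ suc) (G ∘ suc) (g≡G ∘ suc))

countPairs-mono : ∀ n {P Q} → (∀ u v → P u v ≡ true → Q u v ≡ true) → countPairs n P ≤ countPairs n Q
countPairs-mono n P⇒Q =
  sum-map-mono-≤ (allFin n) (λ u → sum-map-mono-≤ (allFin n) (λ v → 𝟙-mono (P⇒Q u v)))

countPairs-toℕ : ∀ n (P : ℕ → ℕ → Bool) →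
                 countPairs n (λ u v → P (toℕ u) (toℕ v)) ≡ ∑< n (λ u → ∑< n (λ v → 𝟙 (P u v)))
countPairs-toℕ n P =
  trans (cong sum (map-tabulate id row)) (sum-tabulate n row (λ u → ∑< n (λ v → 𝟙 (P u v))) (λ u →
    trans (cong sum (map-tabulate id (cell u))) (sum-tabulate n (cell u) (λ v → 𝟙 (P (toℕ u) v)) (λ v → refl))))
  where
  cell : Fin n → Fin n → ℕ
  cell u v = 𝟙 (P (toℕ u) (toℕ v))
  row : Fin n → ℕ
  row u = sum (map (cell u) (allFin n))

module Counting (m k : ℕ) where

  open PowerOfCycle (suc m) k

  eF≤edges : ∀ {S E} → IsSubgraph (suc m) k S E → eF (suc m) E ≤ edges (memberℕ S)
  eF≤edges {S} {E} F⊆H = begin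
    eF (suc m) E                                       ≤⟨ countPairs-mono (suc m) {E} {λ u v → edge (toℕ u) (toℕ v)} F⇒H[S] ⟩
    countPairs (suc m) (λ u v → edge (toℕ u) (toℕ v))  ≡⟨ countPairs-toℕ (suc m) edge ⟩
    edges f                                            ∎
    where
    open ≤-Reasoning
    f = memberℕ S
    edge : ℕ → ℕ → Bool
    edge u v = (u <ᵇ v) ∧ f u ∧ f v ∧ adj u v
    F⇒H[S] : ∀ u v → E u v ≡ true → edge (toℕ u) (toℕ v) ≡ true
    F⇒H[S] u v uv with F⊆H u v uv
    ... | u<v , adj-uv , u∈S , v∈S
      rewrite <ᵇ-true u<v | sym (lookup≡memberℕ S u) | []=⇒lookup u∈S
            | sym (lookup≡memberℕ S v) | []=⇒lookup v∈S = adj-uv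

  edges-interval≤eH : ∀ s → edges (interval s) ≤ eH (suc m) k s
  edges-interval≤eH s = begin
    edges (interval s)                              ≤⟨ #pairs-mono (λ u v _ _ → drop-middle (u <ᵇ v) (u <ᵇ s) (ends-below u v)) ⟩
    #pairs (λ u v → (u <ᵇ v) ∧ ends-below u v)      ≡⟨ countPairs-toℕ (suc m) (λ u v → (u <ᵇ v) ∧ ends-below u v) ⟨
    eH (suc m) k s                                  ∎
    where
    open ≤-Reasoning
    ends-below : ℕ → ℕ → Bool
    ends-below u v = (v <ᵇ s) ∧ adj u v
    drop-middle : ∀ a b c → a ∧ b ∧ c ≡ true → a ∧ c ≡ true
    drop-middle true true c abc = abc

k≤2*k*[1+k] : ∀ k → k ≤ 2 * k * suc k
k≤2*k*[1+k] k = ≤-trans (m≤m+n k (k + 0)) (m≤m*n (2 * k) (suc k))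

lemma3p1 : (k : ℕ) → 4 ≤ k → ∃[ N ] ((n : ℕ) → N ≤ n →
    (S : Subset n) (E : Fin n → Fin n → Bool) → IsSubgraph n k S E →
    eF n E ≤ eH n k ∣ S ∣)
lemma3p1 k _ = suc (2 * k * suc k) , bound
  where
  bound : (n : ℕ) → suc (2 * k * suc k) ≤ n → (S : Subset n) (E : Fin n → Fin n → Bool) →
          IsSubgraph n k S E → eF n E ≤ eH n k ∣ S ∣
  bound (suc m) (s≤s big) S E F⊆H = begin
    eF (suc m) E                 ≤⟨ eF≤edges F⊆H ⟩
    edges f                      ≤⟨ edges≤edges-interval k<n (m≤n⇒m≤1+n big) f ⟩
    edges (interval (size f))    ≤⟨ edges-interval≤eH (size f) ⟩
    eH (suc m) k (size f)        ≡⟨ cong (eH (suc m) k) (∣S∣≡∑<memberℕ S) ⟨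
    eH (suc m) k ∣ S ∣           ∎
    where
    open ≤-Reasoning
    open PowerOfCycle (suc m) k using (edges; interval; size; edges≤edges-interval)
    open Counting m k
    f = memberℕ S
    k<n : k < suc m
    k<n = s≤s (≤-trans (k≤2*k*[1+k] k) big)
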